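{- For every $\mu$Stipula$^{\tt DI}$ contract ${\tt C}$ with the Tick-Plus semantics, $(\mathcal{C}_{\tt C},\to_{\tt tp},\preceq)$ is a well-structured transition system.
   Context: A $\mu$Stipula contract ${\tt C}$ consists of a finite set of states, an initial state, and a finite set of functions $@{\tt Q}\; {\tt f}\,\{W\} \Rightarrow @{\tt Q}'$, where $W$ is a finite sequence of events ${\tt now}+k \gg @{\tt Q}_1 \Rightarrow @{\tt Q}_2$ (${\tt Q}_1$ is the event's initial state), each event occurrence carrying a unique line index $n$. A pending event is $k \gg_n {\tt Q}_1 \Rightarrow {\tt Q}_2$. A configuration is ${\tt C}({\tt Q},\Sigma,\Psi)$ with ${\tt Q}$ a state of ${\tt C}$, $\Psi$ a finite multiset of pending events (written with $|$, empty $\_$), and $\Sigma$ either empty ($\_$) or $\Psi'\Rightarrow{\tt Q}'$; $\mathcal{C}_{\tt C}$ is the set of configurations of ${\tt C}$. $\mathit{nored}(\Psi,{\tt Q})$ holds iff $\Psi$ has no pending event $0\gg_n {\tt Q}\Rightarrow {\tt Q}'$; $\Psi\!\downarrow$ deletes pending events with time $0$ and decrements all others. Let $\mathtt{InitEv}({\tt C})$ be the set of initial states of events in ${\tt C}$. The relation $\to_{\tt tp}$ is: (Function) if $@{\tt Q}\,{\tt f}\{W\}\Rightarrow@{\tt Q}'$ is in ${\tt C}$ and $\mathit{nored}(\Psi,{\tt Q})$, then ${\tt C}({\tt Q},\_,\Psi)\to_{\tt tp}{\tt C}({\tt Q},\Psi_W\Rightarrow{\tt Q}',\Psi)$, with $\Psi_W$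 the multiset of $k\gg_n{\tt Q}_1\Rightarrow{\tt Q}_2$ for the events of $W$; (State-Change) ${\tt C}({\tt Q},\Psi'\Rightarrow{\tt Q}',\Psi)\to_{\tt tp}{\tt C}({\tt Q}',\_,\Psi'|\Psi)$; (Event-Match) ${\tt C}({\tt Q},\_,0\gg_n{\tt Q}\Rightarrow{\tt Q}'\,|\,\Psi')\to_{\tt tp}{\tt C}({\tt Q},\_\Rightarrow{\tt Q}',\Psi')$; (Tick-Plus) if ${\tt Q}\notin\mathtt{InitEv}({\tt C})$ then ${\tt C}({\tt Q},\_,\Psi)\to_{\tt tp}{\tt C}({\tt Q},\_,\Psi\!\downarrow)$. $\mu$Stipula$^{\tt DI}$ is the fragment of contracts in which every event has time expression ${\tt now}+0$ and no state is both the initial state of a function and the initial state of an event. The quasi-order $\preceq$ on configurations: ${\tt C}({\tt Q},\Sigma,\Psi)\preceq{\tt C}({\tt Q},\Sigma,\Psi')$ iff $\Psi$ is included in $\Psi'$ as multisets (same state and same $\Sigma$). A well-structured transition system is $(\mathcal{C},\to,\preceq)$ with $\preceq$ a quasi-order on $\mathcal{C}$ that is a well-quasi-ordering (every infinite sequence $x_1,x_2,\dots$ has $i<j$ with $x_i\preceq x_j$) and upward compatible with $\to$: whenever $\mathbb{C}_1\preceq\mathbb{C}_1'$ and $\mathbb{C}_1\to\mathbb{C}_2$, there is $\mathbb{C}_2'$ with $\mathbb{C}_1'\to^*\mathbb{C}_2'$ and $\mathbb{C}_2\preceq\mathbb{C}_2'$. -}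

module Defs where

open import Data.Nat using (ℕ; zero; suc; _<_; _≤_)
open import Data.Fin using (Fin)
open import Data.List using (List; []; _∷_; _++_; map; concatMap)
open import Data.List.Membership.Propositional using (_∈_)
open import Data.List.Relation.Unary.Unique.Propositional using (Unique)
open import Data.List.Relation.Binary.Permutation.Propositional using (_↭_)
open import Data.Maybe using (Maybe; just; nothing)
open import Data.Product using (Σ; _×_; _,_; ∃; ∃-syntax; proj₁)
open import Relation.Nullary using (¬_)
open import Relation.Binary.PropositionalEquality using (_≡_)
open import Relation.Binary.Construct.Closure.ReflexiveTransitive using (Star)

-- an event  now + time ≫ @src ⇒ @tgt  occurring at line index idx
record Event (n : ℕ) : Set where
  constructor event
  field
    time : ℕ
    idx  : ℕ
    src  : Fin n
    tgt  : Fin n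

-- a function  @src f { events } ⇒ @tgt
record Fun (n : ℕ) : Set where
  constructor fun
  field
    src    : Fin n
    events : List (Event n)
    tgt    : Fin n

allEvents : ∀ {n} → List (Fun n) → List (Event n)
allEvents = concatMap Fun.events

record Contract : Set where
  field
    nStates   : ℕ
    init      : Fin nStates
    funs      : List (Fun nStates)
    uniqueIdx : Unique (map Event.idx (allEvents funs))

open Contract public

InitEv : (C : Contract) → Fin (nStates C) → Set
InitEv C Q = ∃[ f ] (f ∈ funs C × ∃[ e ] (e ∈ Fun.events f × Event.src e ≡ Q))

InitFun : (C : Contract) → Fin (nStates C) → Set
InitFun C Q = ∃[ f ] (f ∈ funs C × Fun.src f ≡ Q)

IsDI : Contract → Set
IsDI C = (∀ f → f ∈ funs C → ∀ e → e ∈ Fun.events f → Event.time e ≡ 0)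
       × (∀ Q → ¬ (InitFun C Q × InitEv C Q))

-- pending event  time ≫_idx src ⇒ tgt
record Pending (n : ℕ) : Set where
  constructor pend
  field
    time : ℕ
    idx  : ℕ
    src  : Fin n
    tgt  : Fin n

toPending : ∀ {n} → Event n → Pending n
toPending (event k i q q') = pend k i q q'

ΨW : ∀ {n} → Fun n → List (Pending n)
ΨW f = map toPending (Fun.events f)

_⊆ₘ_ : ∀ {n} → List (Pending n) → List (Pending n) → Set
Ψ ⊆ₘ Ψ' = ∃[ Δ ] (Ψ' ↭ Ψ ++ Δ)

nored : ∀ {n} → List (Pending n) → Fin n → Set
nored Ψ Q = ¬ (∃[ p ] (p ∈ Ψ × Pending.time p ≡ 0 × Pending.src p ≡ Q))

_↓ : ∀ {n} → List (Pending n) → List (Pending n)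
[] ↓ = []
(pend zero i q q' ∷ Ψ) ↓ = Ψ ↓
(pend (suc k) i q q' ∷ Ψ) ↓ = pend k i q q' ∷ (Ψ ↓)

-- raw configuration C(Q, Σ, Ψ); Σ = nothing is "_", Σ = just (Ψ' , Q') is Ψ' ⇒ Q'
record RawCfg (n : ℕ) : Set where
  constructor cfg
  field
    state : Fin n
    sigma : Maybe (List (Pending n) × Fin n)
    psi   : List (Pending n)

data _⊢_⟶tp_ (C : Contract) : RawCfg (nStates C) → RawCfg (nStates C) → Set where
  function : ∀ {f Ψ} → f ∈ funs C → nored Ψ (Fun.src f) →
    C ⊢ cfg (Fun.src f) nothing Ψ ⟶tp cfg (Fun.src f) (just (ΨW f , Fun.tgt f)) Ψ
  stateChange : ∀ {Q Ψ' Q' Ψ} →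
    C ⊢ cfg Q (just (Ψ' , Q')) Ψ ⟶tp cfg Q' nothing (Ψ' ++ Ψ)
  eventMatch : ∀ {Q Q' i Ψ Ψ'} → Ψ ↭ (pend 0 i Q Q' ∷ Ψ') →
    C ⊢ cfg Q nothing Ψ ⟶tp cfg Q (just ([] , Q')) Ψ'
  tickPlus : ∀ {Q Ψ} → ¬ InitEv C Q →
    C ⊢ cfg Q nothing Ψ ⟶tp cfg Q nothing (Ψ ↓)

-- a pending event of C: an instance of an event line of C (time possibly decremented)
PendingOf : (C : Contract) → Pending (nStates C) → Set
PendingOf C p = ∃[ e ] (e ∈ allEvents (funs C)
  × Pending.idx p ≡ Event.idx e × Pending.src p ≡ Event.src e
  × Pending.tgt p ≡ Event.tgt e × Pending.time p ≤ Event.time e)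

data SigmaOf (C : Contract) : Maybe (List (Pending (nStates C)) × Fin (nStates C)) → Set where
  empty   : SigmaOf C nothing
  fromFun : ∀ {f Ψ'} → f ∈ funs C → Ψ' ↭ ΨW f → SigmaOf C (just (Ψ' , Fun.tgt f))
  fromEv  : ∀ {Q'} → SigmaOf C (just ([] , Q'))

data AllPending (C : Contract) : List (Pending (nStates C)) → Set where
  []  : AllPending C []
  _∷_ : ∀ {p Ψ} → PendingOf C p → AllPending C Ψ → AllPending C (p ∷ Ψ)

record IsCfgOf (C : Contract) (c : RawCfg (nStates C)) : Set where
  field
    sigmaOK : SigmaOf C (RawCfg.sigma c)
    psiOK   : AllPending C (RawCfg.psi c)

Cfg : Contract → Set
Cfg C = Σ (RawCfg (nStates C)) (IsCfgOf C)

_⊢_⟶_ : (C : Contract) → Cfg C → Cfg C → Set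
C ⊢ a ⟶ b = C ⊢ proj₁ a ⟶tp proj₁ b

data SameΣ {n : ℕ} : Maybe (List (Pending n) × Fin n) → Maybe (List (Pending n) × Fin n) → Set where
  none : SameΣ nothing nothing
  some : ∀ {Ψ₁ Ψ₂ Q} → Ψ₁ ↭ Ψ₂ → SameΣ (just (Ψ₁ , Q)) (just (Ψ₂ , Q))

_⪯raw_ : ∀ {n} → RawCfg n → RawCfg n → Set
cfg Q Σ₁ Ψ ⪯raw cfg Q' Σ₂ Ψ' = (Q ≡ Q') × SameΣ Σ₁ Σ₂ × (Ψ ⊆ₘ Ψ')

_⊢_⪯_ : (C : Contract) → Cfg C → Cfg C → Set
C ⊢ a ⪯ b = proj₁ a ⪯raw proj₁ b

record IsWSTS (A : Set) (_⟶_ : A → A → Set) (_≼_ : A → A → Set) : Set where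
  field
    ≼-refl  : ∀ x → x ≼ x
    ≼-trans : ∀ {x y z} → x ≼ y → y ≼ z → x ≼ z
    wqo     : (x : ℕ → A) → ∃[ i ] ∃[ j ] (i < j × x i ≼ x j)
    upward  : ∀ {c₁ c₁' c₂} → c₁ ≼ c₁' → c₁ ⟶ c₂ →
              ∃[ c₂' ] (Star _⟶_ c₁' c₂' × c₂ ≼ c₂')

-- In μStipula^DI every event is scheduled at now + 0, so every pending event of a
-- configuration is 0 ≫ₙ Q ⇒ Q′ for one of the finitely many event lines of C; in
-- particular Ψ ↓ is always empty.  Hence ⪯ follows from equality of the states and of
-- the shapes of Σ (empty, Ψ_W of a given function, or _ ⇒ Q′) together with the
-- pointwise order on the vectors counting how often each event line occurs in Ψ, and
-- that order is a wqo by Dickson's lemma.  Dickson's lemma is proved constructively with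
-- almost-full relations, whose intersection is almost full by the intuitionistic Ramsey
-- theorem.  Upward compatibility holds with a single matching step: extra pending
-- events never block a function, because they are all due and no function starts in
-- an event's initial state; every other rule touches Ψ only in the part it shares with
-- the smaller configuration.

module Submission where

open import Defs
open import Level using (0ℓ)
open import Data.Bool using (if_then_else_)
open import Data.Nat as ℕ using (ℕ; zero; suc; _<_; _≤_; z≤n; s≤s; _≤?_)
open import Data.Nat.Properties using (≤-refl; ≤-trans; ≤-pred; ≤-reflexive; ≰⇒>; n≤0⇒n≡0)
open import Data.Fin as Fin using (Fin; zero; suc)
open import Data.Fin.Properties using (suc-injective)
open import Data.List using (List; []; _∷_; _++_; length; lookup; filter)
open import Data.List.Properties using (++-assoc; ++-identityʳ)
open import Data.List.Membership.Propositional using (_∈_; find; lose)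
open import Data.List.Membership.Propositional.Properties using (∈-∃++; ∈-concatMap⁻; ∈-concatMap⁺)
open import Data.List.Relation.Unary.All as All using (All; []; _∷_)
open import Data.List.Relation.Unary.All.Properties as All using ()
open import Data.List.Relation.Unary.Any using (here; there; index)
open import Data.List.Relation.Unary.Any.Properties using (lookup-index)
open import Data.List.Relation.Binary.Permutation.Propositional
  using (_↭_; ↭-refl; ↭-sym; ↭-trans; ↭-reflexive; prep)
open import Data.List.Relation.Binary.Permutation.Propositional.Properties
  using (All-resp-↭; ++⁺; ++⁺ʳ; ↭-length; filter-↭; shift)
open import Data.Maybe using (Maybe; just; nothing)
open import Data.Product using (_×_; _,_; ∃-syntax; proj₁; proj₂; swap)
open import Data.Product.Properties using (≡-dec)
open import Data.Sum using (inj₁; inj₂; [_,_]′)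
import Data.Sum as Sum
open import Data.Vec.Functional using (Vector; head; tail)
open import Data.Vec.Functional.Relation.Binary.Pointwise using (Pointwise)
open import Function using (_∘_; _on_; id)
open import Relation.Nullary using (Dec; yes; no; does; contradiction)
open import Relation.Nullary.Decidable using (map′)
open import Relation.Unary using (Pred)
open import Relation.Binary.Core using (Rel; _⇒_)
open import Relation.Binary.Definitions using (Universal; DecidableEquality)
open import Relation.Binary.Construct.Union using (_∪_)
open import Relation.Binary.Construct.Intersection using (_∩_)
open import Relation.Binary.Construct.Constant.Core using (Const)
open import Relation.Binary.Construct.Never using (Never)
open import Relation.Binary.PropositionalEquality using (_≡_; refl; sym; trans; cong; subst; subst₂)
open import Relation.Binary.Construct.Closure.ReflexiveTransitive using (ε; _◅_)

Fst : {X : Set} → Pred X 0ℓ → Rel X 0ℓ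
Fst U x _ = U x

_↑_ : {X : Set} → Rel X 0ℓ → X → Rel X 0ℓ
R ↑ x = R ∪ Fst (R x)

-- The inductive almost-full relations of Vytiniotis, Coquand and Wahlstedt (ITP 2012).
data AlmostFull {X : Set} (R : Rel X 0ℓ) : Set where
  full : Universal R → AlmostFull R
  lift : (∀ x → AlmostFull (R ↑ x)) → AlmostFull R

module _ {X : Set} where

  private variable
    A B R S T : Rel X 0ℓ
    U V : Pred X 0ℓ
    P Q : Set

  almostFull-mono : R ⇒ S → AlmostFull R → AlmostFull S
  almostFull-mono R⇒S (full r) = full λ x y → R⇒S (r x y)
  almostFull-mono R⇒S (lift r) = lift λ x → almostFull-mono (Sum.map R⇒S R⇒S) (r x)

  almostFull⇒good : AlmostFull R → (f : ℕ → X) → ∃[ i ] ∃[ j ] (i < j × R (f i) (f j))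
  almostFull⇒good (full r) f = 0 , 1 , s≤s z≤n , r _ _
  almostFull⇒good (lift r) f with almostFull⇒good (r (f 0)) (f ∘ suc)
  ... | i , j , i<j , inj₁ r = suc i , suc j , s≤s i<j , r
  ... | i , j , i<j , inj₂ r = 0     , suc i , s≤s z≤n , r

  -- ramsey-lift reduces a pair (S, T) to the pairs of sections (S x, T x), which depend
  -- on one argument fewer; two reductions lead to constant relations, for which
  -- ramsey-Const is a direct induction on both almost-full proofs.
  Ramsey : Rel X 0ℓ → Rel X 0ℓ → Set₁
  Ramsey S T = ∀ {A B R} → AlmostFull A → AlmostFull B → A ⇒ R ∪ S → B ⇒ R ∪ T →
               AlmostFull (R ∪ (S ∩ T))

  Ramsey-sym : Ramsey S T → Ramsey T S
  Ramsey-sym r a b A⇒ B⇒ = almostFull-mono (Sum.map₂ swap) (r b a B⇒ A⇒)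

  private
    ↑-∪-Const : ∀ (R : Rel X 0ℓ) P Q x →
                (R ↑ x) ∪ (Const P ∩ Const Q) ⇒ (R ∪ (Const P ∩ Const Q)) ↑ x
    ↑-∪-Const _ _ _ _ = [ Sum.map inj₁ inj₁ , inj₁ ∘ inj₂ ]′

    ↑-hyp : ∀ (R : Rel X 0ℓ) (P : Set) x → A ⇒ R ∪ Const P → A ↑ x ⇒ (R ↑ x) ∪ Const P
    ↑-hyp _ _ _ A⇒ (inj₁ a) = Sum.map₁ inj₁ (A⇒ a)
    ↑-hyp _ _ _ A⇒ (inj₂ a) = Sum.map₁ inj₂ (A⇒ a)

    ↑-weaken : ∀ (R S : Rel X 0ℓ) x → A ⇒ R ∪ S → A ⇒ (R ↑ x) ∪ S
    ↑-weaken _ _ _ A⇒ a = Sum.map₁ inj₁ (A⇒ a)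

  ramsey-Const : Ramsey (Const P) (Const Q)
  ramsey-Const {P = P} {Q = Q} {R = R} (full a) (full b) A⇒ B⇒ =
    lift λ x → full λ y z → inj₂ (both (A⇒ (a x y)) (B⇒ (b x y)))
    where
    both : ∀ {x y} → (R ∪ Const P) x y → (R ∪ Const Q) x y → (R ∪ (Const P ∩ Const Q)) x y
    both (inj₁ r) _        = inj₁ r
    both (inj₂ p) (inj₁ r) = inj₁ r
    both (inj₂ p) (inj₂ q) = inj₂ (p , q)
  ramsey-Const {P = P} {Q = Q} {R = R} (lift a) b A⇒ B⇒ = lift λ x →
    almostFull-mono (↑-∪-Const R P Q x)
      (ramsey-Const (a x) b (↑-hyp R P x A⇒) (↑-weaken R (Const Q) x B⇒))
  ramsey-Const {P = P} {Q = Q} {R = R} a (lift b) A⇒ B⇒ = lift λ x →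
    almostFull-mono (↑-∪-Const R P Q x)
      (ramsey-Const a (b x) (↑-weaken R (Const P) x A⇒) (↑-hyp R Q x B⇒))

  private
    module Split (R S T : Rel X 0ℓ) (x : X) where
      Rest : Rel X 0ℓ
      Rest = (R ∪ (S ∩ T)) ∪ Fst (R x)

      ↑-split : Rest ∪ (Fst (S x) ∩ Fst (T x)) ⇒ (R ∪ (S ∩ T)) ↑ x
      ↑-split = [ Sum.map₂ inj₁ , inj₂ ∘ inj₂ ]′

      full-case : A ⇒ R ∪ S → ∀ {y z} → A x y → (Rest ∪ Fst (S x)) y z
      full-case A⇒ a = [ inj₁ ∘ inj₂ , inj₂ ]′ (A⇒ a)

      lift-hyp : A ⇒ R ∪ S → A ↑ x ⇒ ((R ↑ x) ∪ Fst (S x)) ∪ S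
      lift-hyp A⇒ (inj₁ a) = Sum.map₁ (inj₁ ∘ inj₁) (A⇒ a)
      lift-hyp A⇒ (inj₂ a) = inj₁ (Sum.map₁ inj₂ (A⇒ a))

      lift-weaken : B ⇒ R ∪ T → B ⇒ ((R ↑ x) ∪ Fst (S x)) ∪ T
      lift-weaken B⇒ b = Sum.map₁ (inj₁ ∘ inj₁) (B⇒ b)

      lift-result : ((R ↑ x) ∪ Fst (S x)) ∪ (S ∩ T) ⇒ Rest ∪ Fst (S x)
      lift-result (inj₁ (inj₁ (inj₁ r))) = inj₁ (inj₁ (inj₁ r))
      lift-result (inj₁ (inj₁ (inj₂ r))) = inj₁ (inj₂ r)
      lift-result (inj₁ (inj₂ s))        = inj₂ s
      lift-result (inj₂ st)              = inj₁ (inj₁ (inj₂ st))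

      swap-rest : (R ∪ (T ∩ S)) ∪ Fst (R x) ⇒ Rest
      swap-rest = Sum.map₁ (Sum.map₂ swap)

  open Split

  mutual
    ramsey-lift : (∀ x → Ramsey (Fst (S x)) (Fst (T x))) → Ramsey S T
    ramsey-lift {S = S} {T = T} sections {R = R} a b A⇒ B⇒ = lift λ x →
      almostFull-mono (↑-split R S T x)
        (sections x (ramsey-lift-side sections a b A⇒ B⇒ x)
          (almostFull-mono (Sum.map₁ (swap-rest R S T x))
            (ramsey-lift-side (λ x → Ramsey-sym (sections x)) b a B⇒ A⇒ x))
          id id)

    ramsey-lift-side : (∀ x → Ramsey (Fst (S x)) (Fst (T x))) →
                       AlmostFull A → AlmostFull B → A ⇒ R ∪ S → B ⇒ R ∪ T →
                       ∀ x → AlmostFull (Rest R S T x ∪ Fst (S x))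
    ramsey-lift-side {S = S} {T = T} {R = R} _ (full a) b A⇒ B⇒ x =
      full λ y z → full-case R S T x A⇒ (a x y)
    ramsey-lift-side {S = S} {T = T} {R = R} sections (lift a) b A⇒ B⇒ x =
      almostFull-mono (lift-result R S T x)
        (ramsey-lift sections (a x) b (lift-hyp R S T x A⇒) (lift-weaken R S T x B⇒))

  ramsey-Fst : Ramsey (Fst U) (Fst V)
  ramsey-Fst = ramsey-lift λ _ → ramsey-Const

  ramsey : Ramsey S T
  ramsey = ramsey-lift λ _ → ramsey-Fst

  almostFull-∩ : AlmostFull R → AlmostFull S → AlmostFull (R ∩ S)
  almostFull-∩ r s = almostFull-mono [ (λ ()) , id ]′ (ramsey {R = Never} r s inj₂ inj₂)

almostFull-on : ∀ {X Y : Set} {R : Rel X 0ℓ} (f : Y → X) → AlmostFull R → AlmostFull (R on f)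
almostFull-on f (full r) = full λ x y → r (f x) (f y)
almostFull-on f (lift r) = lift λ y → almostFull-on f (r (f y))

≤-↑-almostFull : ∀ x → AlmostFull (_≤_ ↑ x)
≤-↑-almostFull zero    = full λ _ _ → inj₂ z≤n
≤-↑-almostFull (suc x) = lift λ w → step w (w ≤? x)
  where
  step : ∀ w → Dec (w ≤ x) → AlmostFull ((_≤_ ↑ suc x) ↑ w)
  step w (yes w≤x) = almostFull-mono [ inj₁ ∘ inj₁ , inj₂ ∘ inj₁ ∘ ≤-trans w≤x ]′ (≤-↑-almostFull x)
  step w (no w≰x)  = full λ _ _ → inj₂ (inj₂ (≰⇒> w≰x))

≤-almostFull : AlmostFull _≤_
≤-almostFull = lift ≤-↑-almostFull

pointwise-≤-almostFull : ∀ n → AlmostFull (Pointwise _≤_ {n})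
pointwise-≤-almostFull zero    = full λ _ _ ()
pointwise-≤-almostFull (suc n) =
  almostFull-mono (λ { (h , t) zero → h ; (h , t) (suc i) → t i })
    (almostFull-∩ (almostFull-on head ≤-almostFull) (almostFull-on tail (pointwise-≤-almostFull n)))

indicator : ∀ {n} → Fin n → Vector ℕ n
indicator i j = if does (i Fin.≟ j) then 1 else 0

indicator-≤⇒≡ : ∀ {n} {i j : Fin n} → Pointwise _≤_ (indicator i) (indicator j) → i ≡ j
indicator-≤⇒≡ {i = i} {j} le with i Fin.≟ i | j Fin.≟ i | le i
... | yes _   | yes j≡i | _  = sym j≡i
... | yes _   | no _    | ()
... | no i≢i | _       | _  = contradiction refl i≢i

≡-almostFull : ∀ n → AlmostFull (_≡_ {A = Fin n})
≡-almostFull n = almostFull-mono indicator-≤⇒≡ (almostFull-on indicator (pointwise-≤-almostFull n))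

module _ {A : Set} where

  infix 4 _⊑_

  _⊑_ : List A → List A → Set
  xs ⊑ ys = ∃[ zs ] (ys ↭ xs ++ zs)

  ⊑-refl : ∀ {xs} → xs ⊑ xs
  ⊑-refl {xs} = [] , ↭-reflexive (sym (++-identityʳ xs))

  ⊑-trans : ∀ {xs ys zs} → xs ⊑ ys → ys ⊑ zs → xs ⊑ zs
  ⊑-trans {xs} (ds₁ , p₁) (ds₂ , p₂) =
    ds₁ ++ ds₂ , ↭-trans p₂ (↭-trans (++⁺ʳ ds₂ p₁) (↭-reflexive (++-assoc xs ds₁ ds₂)))

  ↭-++-⊑ : ∀ {xs xs′ ys ys′} → xs ↭ xs′ → ys ⊑ ys′ → xs ++ ys ⊑ xs′ ++ ys′
  ↭-++-⊑ {xs} {ys = ys} p (ds , q) =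
    ds , ↭-trans (++⁺ (↭-sym p) q) (↭-reflexive (sym (++-assoc xs ys ds)))

  module _ (_≟_ : DecidableEquality A) where

    count : A → List A → ℕ
    count x xs = length (filter (x ≟_) xs)

    count-↭ : ∀ x {xs ys} → xs ↭ ys → count x xs ≡ count x ys
    count-↭ x p = ↭-length (filter-↭ (x ≟_) p)

    0<count-∷ : ∀ x xs → 0 < count x (x ∷ xs)
    0<count-∷ x xs with x ≟ x
    ... | yes _   = s≤s z≤n
    ... | no x≢x = contradiction refl x≢x

    0<count⇒∈ : ∀ {x} ys → 0 < count x ys → x ∈ ys
    0<count⇒∈ {x} (y ∷ ys) pos with x ≟ y
    ... | yes x≡y = here x≡y
    ... | no _    = there (0<count⇒∈ ys pos)

    count-∷-cancel : ∀ x y xs ys → count x (y ∷ xs) ≤ count x (y ∷ ys) → count x xs ≤ count x ys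
    count-∷-cancel x y xs ys le with x ≟ y
    ... | yes _ = ≤-pred le
    ... | no _  = le

    count-≤⇒⊑ : ∀ xs ys → (∀ {x} → x ∈ xs → count x xs ≤ count x ys) → xs ⊑ ys
    count-≤⇒⊑ []       ys _  = ys , ↭-refl
    count-≤⇒⊑ (x ∷ xs) ys le
      with ys₁ , ys₂ , refl ← ∈-∃++ (0<count⇒∈ ys (≤-trans (0<count-∷ x xs) (le (here refl))))
      with zs , ys↭ ← count-≤⇒⊑ xs (ys₁ ++ ys₂) (λ {q} q∈ → count-∷-cancel q x xs (ys₁ ++ ys₂)
                        (≤-trans (le (there q∈)) (≤-reflexive (count-↭ q (shift x ys₁ ys₂)))))
      = zs , ↭-trans (shift x ys₁ ys₂) (prep x ys↭)

module _ {n : ℕ} where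

  _≟ₚ_ : DecidableEquality (Pending n)
  pend k i q r ≟ₚ pend k′ i′ q′ r′ =
    map′ (λ { refl → refl }) (λ { refl → refl })
      (≡-dec ℕ._≟_ (≡-dec ℕ._≟_ (≡-dec Fin._≟_ Fin._≟_)) (k , i , q , r) (k′ , i′ , q′ , r′))

  SameΣ-refl : ∀ {σ} → SameΣ {n} σ σ
  SameΣ-refl {nothing} = none
  SameΣ-refl {just _}  = some ↭-refl

  SameΣ-trans : ∀ {σ₁ σ₂ σ₃} → SameΣ {n} σ₁ σ₂ → SameΣ σ₂ σ₃ → SameΣ σ₁ σ₃
  SameΣ-trans none     none     = none
  SameΣ-trans (some p) (some q) = some (↭-trans p q)

module _ {C : Contract} where

  private
    Events : List (Event (nStates C))
    Events = allEvents (funs C)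

  ⪯-refl : ∀ c → C ⊢ c ⪯ c
  ⪯-refl _ = refl , SameΣ-refl , ⊑-refl

  ⪯-trans : ∀ {c₁ c₂ c₃} → C ⊢ c₁ ⪯ c₂ → C ⊢ c₂ ⪯ c₃ → C ⊢ c₁ ⪯ c₃
  ⪯-trans {cfg _ _ _ , _} {cfg _ _ _ , _} {cfg _ _ _ , _} (q₁ , σ₁ , Ψ₁) (q₂ , σ₂ , Ψ₂) =
    trans q₁ q₂ , SameΣ-trans σ₁ σ₂ , ⊑-trans Ψ₁ Ψ₂

  AllPending⇒All : ∀ {Ψ} → AllPending C Ψ → All (PendingOf C) Ψ
  AllPending⇒All []       = []
  AllPending⇒All (p ∷ ps) = p ∷ AllPending⇒All ps

  All⇒AllPending : ∀ {Ψ} → All (PendingOf C) Ψ → AllPending C Ψ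
  All⇒AllPending []       = []
  All⇒AllPending (p ∷ ps) = p ∷ All⇒AllPending ps

  config : (Q : Fin (nStates C)) {σ : Maybe (List (Pending (nStates C)) × Fin (nStates C))}
           {Ψ : List (Pending (nStates C))} → SigmaOf C σ → All (PendingOf C) Ψ → Cfg C
  config Q {σ} {Ψ} σ-ok Ψ-ok = cfg Q σ Ψ , record { sigmaOK = σ-ok ; psiOK = All⇒AllPending Ψ-ok }

  psi-valid : (c : Cfg C) → All (PendingOf C) (RawCfg.psi (proj₁ c))
  psi-valid (_ , ok) = AllPending⇒All (IsCfgOf.psiOK ok)

  toPending-valid : ∀ {e} → e ∈ Events → PendingOf C (toPending e)
  toPending-valid {event _ _ _ _} e∈ = _ , e∈ , refl , refl , refl , ≤-refl

  sigma-valid : ∀ {Ψ Q} → SigmaOf C (just (Ψ , Q)) → All (PendingOf C) Ψ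
  sigma-valid (fromFun f∈ Ψ↭) = All-resp-↭ (↭-sym Ψ↭) (All.map⁺ (All.tabulate λ e∈ →
    toPending-valid (∈-concatMap⁺ Fun.events {xs = funs C} (lose f∈ e∈))))
  sigma-valid fromEv = []

  funTag : ∀ {σ} → SigmaOf C σ → Fin (suc (length (funs C)))
  funTag (fromFun f∈ _) = suc (index f∈)
  funTag _              = zero

  eventTag : ∀ {σ} → SigmaOf C σ → Fin (suc (nStates C))
  eventTag (fromEv {Q' = Q′}) = suc Q′
  eventTag _                  = zero

  sameTags⇒SameΣ : ∀ {σ σ′} (s : SigmaOf C σ) (s′ : SigmaOf C σ′) →
                   funTag s ≡ funTag s′ → eventTag s ≡ eventTag s′ → SameΣ σ σ′
  sameTags⇒SameΣ empty           empty             _  _    = none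
  sameTags⇒SameΣ empty           (fromFun _ _)     () _
  sameTags⇒SameΣ empty           fromEv            _  ()
  sameTags⇒SameΣ (fromFun _ _)   empty             () _
  sameTags⇒SameΣ (fromFun f∈ Ψ↭) (fromFun f′∈ Ψ′↭) same _
    with refl ← trans (lookup-index f∈)
                  (trans (cong (lookup (funs C)) (suc-injective same)) (sym (lookup-index f′∈)))
    = some (↭-trans Ψ↭ (↭-sym Ψ′↭))
  sameTags⇒SameΣ (fromFun _ _)   fromEv            () _
  sameTags⇒SameΣ fromEv          empty             _  ()
  sameTags⇒SameΣ fromEv          (fromFun _ _)     () _
  sameTags⇒SameΣ fromEv          fromEv            _  refl = some ↭-refl

  counts : List (Pending (nStates C)) → Vector ℕ (length Events)
  counts Ψ k = count _≟ₚ_ (toPending (lookup Events k)) Ψ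

  Embeds : Rel (Cfg C) 0ℓ
  Embeds = (_≡_ on state) ∩ ((_≡_ on funTag ∘ sigma) ∩ ((_≡_ on eventTag ∘ sigma) ∩
                                                         (Pointwise _≤_ on counts ∘ psi)))
    where
    state : Cfg C → Fin (nStates C)
    state = RawCfg.state ∘ proj₁
    sigma : (c : Cfg C) → SigmaOf C (RawCfg.sigma (proj₁ c))
    sigma = IsCfgOf.sigmaOK ∘ proj₂
    psi : Cfg C → List (Pending (nStates C))
    psi = RawCfg.psi ∘ proj₁

  almostFull-Embeds : AlmostFull Embeds
  almostFull-Embeds =
    almostFull-∩ (almostFull-on _ (≡-almostFull _))
      (almostFull-∩ (almostFull-on _ (≡-almostFull _))
        (almostFull-∩ (almostFull-on _ (≡-almostFull _))
          (almostFull-on _ (pointwise-≤-almostFull _))))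

  module _ (di : IsDI C) where

    event-time≡0 : ∀ {e} → e ∈ Events → Event.time e ≡ 0
    event-time≡0 e∈ with f , f∈ , e∈f ← find (∈-concatMap⁻ Fun.events {xs = funs C} e∈) =
      proj₁ di f f∈ _ e∈f

    pending≡toPending : ∀ {p} → PendingOf C p → ∃[ e ] (e ∈ Events × p ≡ toPending e)
    pending≡toPending {pend _ _ _ _} (event _ _ _ _ , e∈ , refl , refl , refl , t≤)
      with event-time≡0 e∈ | t≤
    ... | refl | z≤n = _ , e∈ , refl

    pending-time≡0 : ∀ {p} → PendingOf C p → Pending.time p ≡ 0
    pending-time≡0 (_ , e∈ , _ , _ , _ , t≤) = n≤0⇒n≡0 (subst (_ ≤_) (event-time≡0 e∈) t≤)

    ↓-valid : ∀ {Ψ} → All (PendingOf C) Ψ → Ψ ↓ ≡ []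
    ↓-valid [] = refl
    ↓-valid {pend _ _ _ _ ∷ _} (p ∷ ps) with refl ← pending-time≡0 p = ↓-valid ps

    nored-valid : ∀ {Ψ f} → All (PendingOf C) Ψ → f ∈ funs C → nored Ψ (Fun.src f)
    nored-valid {f = f} ps f∈ (p , p∈ , _ , p-src)
      with e , e∈ , _ , e-src , _ ← All.lookup ps p∈
      with f′ , f′∈ , e∈f′ ← find (∈-concatMap⁻ Fun.events {xs = funs C} e∈) =
      proj₂ di (Fun.src f) ((f , f∈ , refl) , (f′ , f′∈ , e , e∈f′ , trans (sym e-src) p-src))

    simulate : ∀ {c₁ c₁′ c₂} → C ⊢ c₁ ⪯ c₁′ → C ⊢ c₁ ⟶ c₂ →
               ∃[ c₂′ ] (C ⊢ c₁′ ⟶ c₂′ × C ⊢ c₂ ⪯ c₂′)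
    simulate {c₁′ = c₁′} (refl , none , Ψ⊑) (function {f} f∈ _) =
      config (Fun.src f) (fromFun f∈ ↭-refl) (psi-valid c₁′) ,
      function f∈ (nored-valid (psi-valid c₁′) f∈) ,
      refl , some ↭-refl , Ψ⊑
    simulate {c₁′ = c₁′@(_ , ok′)} (refl , some Ψ₁↭Ψ₂ , Ψ⊑) (stateChange {Q' = Q′}) =
      config Q′ empty (All.++⁺ (sigma-valid (IsCfgOf.sigmaOK ok′)) (psi-valid c₁′)) ,
      stateChange ,
      refl , none , ↭-++-⊑ Ψ₁↭Ψ₂ Ψ⊑
    simulate {c₁′ = c₁′@(cfg _ _ Ψ′ , _)} (refl , none , Δ , Ψ′↭Ψ++Δ)
             (eventMatch {Q} {Q′} {i} {Ψ' = Ψr} Ψ↭) =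
      config Q fromEv (All.tail (All-resp-↭ Ψ′↭event (psi-valid c₁′))) ,
      eventMatch Ψ′↭event ,
      refl , some ↭-refl , Δ , ↭-refl
      where
      Ψ′↭event : Ψ′ ↭ pend 0 i Q Q′ ∷ Ψr ++ Δ
      Ψ′↭event = ↭-trans Ψ′↭Ψ++Δ (++⁺ʳ Δ Ψ↭)
    simulate {c₁} {c₁′@(cfg Q _ Ψ′ , _)} (refl , none , _) (tickPlus Q∉) =
      config Q empty (subst (All (PendingOf C)) (sym Ψ′↓≡[]) []) ,
      tickPlus Q∉ ,
      refl , none , subst₂ _⊑_ (sym (↓-valid (psi-valid c₁))) (sym Ψ′↓≡[]) ⊑-refl
      where
      Ψ′↓≡[] : Ψ′ ↓ ≡ []
      Ψ′↓≡[] = ↓-valid (psi-valid c₁′)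

    counts-≤⇒⊆ₘ : ∀ {Ψ Ψ′} → All (PendingOf C) Ψ → Pointwise _≤_ (counts Ψ) (counts Ψ′) →
                  Ψ ⊆ₘ Ψ′
    counts-≤⇒⊆ₘ {Ψ} {Ψ′} valid le =
      count-≤⇒⊑ _≟ₚ_ Ψ Ψ′ λ q∈ → bound (pending≡toPending (All.lookup valid q∈))
      where
      bound : ∀ {q} → ∃[ e ] (e ∈ Events × q ≡ toPending e) → count _≟ₚ_ q Ψ ≤ count _≟ₚ_ q Ψ′
      bound (e , e∈ , refl) = subst (λ e → count _≟ₚ_ (toPending e) Ψ ≤ count _≟ₚ_ (toPending e) Ψ′)
                                    (sym (lookup-index e∈)) (le (index e∈))

    Embeds⇒⪯ : ∀ {c c′} → Embeds c c′ → C ⊢ c ⪯ c′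
    Embeds⇒⪯ {c@(_ , ok)} {_ , ok′} (same-state , same-fun , same-event , le) =
      same-state ,
      sameTags⇒SameΣ (IsCfgOf.sigmaOK ok) (IsCfgOf.sigmaOK ok′) same-fun same-event ,
      counts-≤⇒⊆ₘ (psi-valid c) le

    ⪯-almostFull : AlmostFull (C ⊢_⪯_)
    ⪯-almostFull = almostFull-mono (λ {c} {c′} → Embeds⇒⪯ {c} {c′}) almostFull-Embeds

lemma1 : (C : Contract) → IsDI C → IsWSTS (Cfg C) (C ⊢_⟶_) (C ⊢_⪯_)
lemma1 C di = record
  { ≼-refl  = ⪯-refl
  ; ≼-trans = λ {c₁} {c₂} {c₃} → ⪯-trans {c₁ = c₁} {c₂} {c₃}
  ; wqo     = almostFull⇒good (⪯-almostFull di)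
  ; upward  = λ {c₁} {c₁′} {c₂} c₁⪯c₁′ step →
      let c₂′ , step′ , c₂⪯c₂′ = simulate di {c₁} {c₁′} {c₂} c₁⪯c₁′ step
      in  c₂′ , step′ ◅ ε , c₂⪯c₂′
  }
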